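{- Let $(M,\to)$ be a transition system and $P_1,P_2,Q\subseteq M$. If $(M,\to)\models^\forall P_i\Rightarrow Q$ for $i=1,2$, then $(M,\to)\models^\forall P_1\cup P_2\Rightarrow Q$.
   Context: For $P\subseteq M$, $\partial(P)=\{\gamma'\mid\gamma\to\gamma'\text{ for some }\gamma\in P\}$; $P$ is runnable if $P\neq\emptyset$ and every element of $P$ has a successor. $(M,\to)\models^\forall P\Rightarrow Q$ iff $P\Rightarrow Q$ belongs to the greatest fixed point of the rules: (Subsumption) $P\Rightarrow Q$ with no premise if $P\subseteq Q$; (Step) from $\partial(P\setminus Q)\Rightarrow Q$ infer $P\Rightarrow Q$ if $P\setminus Q$ is runnable. -}

module Defs where

open import Level using (Level; suc; _⊔_)
open import Data.Product using (Σ; ∃; _×_; _,_)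
open import Data.Sum using (_⊎_)
open import Relation.Nullary using (¬_)
open import Relation.Unary using (Pred; _⊆_; _∪_)
open import Relation.Binary using (Rel)

module _ {ℓ : Level} {M : Set ℓ} (_⟶_ : Rel M ℓ) where

  _∖_ : Pred M ℓ → Pred M ℓ → Pred M ℓ
  (P ∖ Q) γ = P γ × ¬ Q γ

  ∂ : Pred M ℓ → Pred M ℓ
  ∂ P γ' = ∃ λ γ → P γ × (γ ⟶ γ')

  Runnable : Pred M ℓ → Set ℓ
  Runnable P = (∃ λ γ → P γ) × (∀ {γ} → P γ → ∃ λ γ' → γ ⟶ γ')

  Claims : Set (suc (suc ℓ))
  Claims = Pred M ℓ → Pred M ℓ → Set (suc ℓ)

  Rules : Claims → Pred M ℓ → Pred M ℓ → Set (suc ℓ)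
  Rules X P Q = (P ⊆ Q) ⊎ (Runnable (P ∖ Q) × X (∂ (P ∖ Q)) Q)

  Consistent : Claims → Set (suc ℓ)
  Consistent X = ∀ P Q → X P Q → Rules X P Q

  -- (M , ⟶) ⊨∀ P ⇒ Q : P ⇒ Q lies in the greatest fixed point of the rules,
  -- i.e. (Knaster–Tarski) in the union of all consistent claim sets.
  _⊨∀_⇒_ : Pred M ℓ → Pred M ℓ → Set (suc (suc ℓ))
  _⊨∀_⇒_ P Q = Σ Claims λ X → Consistent X × X P Q

module Submission where

open import Defs
open import Level using (Level)
open import Data.Product using (∃; ∃₂; _×_; _,_)
open import Data.Sum using (_⊎_; inj₁; inj₂; [_,_])
open import Data.Empty using (⊥-elim)
open import Relation.Unary using (Pred; Satisfiable; _⊆_; _∪_; _≐_)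
open import Relation.Unary.Properties using (≐-refl)
open import Relation.Binary using (Rel)

-- Coinduction: join the witnesses of P₁ ⇒ Q and P₂ ⇒ Q together with all
-- subsumption claims into one consistent set X, and close X under binary
-- unions of premises.  The closure is again consistent, since a Step for A ∪ B
-- leads to ∂(A ∖ S) ∪ ∂(B ∖ S) ⇒ S, a union of two claims of X (a subsumed A
-- contributes the empty set ∂(A ∖ S)).

module _ {ℓ : Level} {M : Set ℓ} (_⟶_ : Rel M ℓ) where

  private
    variable
      A B R S : Pred M ℓ

    infixl 6 _∖ₛ_
    _∖ₛ_ : Pred M ℓ → Pred M ℓ → Pred M ℓ
    _∖ₛ_ = _∖_ _⟶_

    ∂ₛ : Pred M ℓ → Pred M ℓ
    ∂ₛ = ∂ _⟶_

  _∪ᶜ_ : Claims _⟶_ → Claims _⟶_ → Claims _⟶_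
  (X ∪ᶜ X′) P Q = X P Q ⊎ X′ P Q

  WithSubsumption : Claims _⟶_ → Claims _⟶_
  WithSubsumption X P Q = X P Q ⊎ P ⊆ Q

  UnionClosure : Claims _⟶_ → Claims _⟶_
  UnionClosure X R S = ∃₂ λ A B → X A S × X B S × R ≐ A ∪ B

  Rules-mono : {X X′ : Claims _⟶_} → (∀ {P Q} → X P Q → X′ P Q) →
               Rules _⟶_ X A S → Rules _⟶_ X′ A S
  Rules-mono X⊆X′ (inj₁ A⊆S)          = inj₁ A⊆S
  Rules-mono X⊆X′ (inj₂ (run , next)) = inj₂ (run , X⊆X′ next)

  consistent-∪ᶜ : {X X′ : Claims _⟶_} → Consistent _⟶_ X → Consistent _⟶_ X′ →
                  Consistent _⟶_ (X ∪ᶜ X′)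
  consistent-∪ᶜ {X} {X′} cX cX′ P Q (inj₁ x)  = Rules-mono {X = X} {X ∪ᶜ X′} inj₁ (cX P Q x)
  consistent-∪ᶜ {X} {X′} cX cX′ P Q (inj₂ x′) = Rules-mono {X = X′} {X ∪ᶜ X′} inj₂ (cX′ P Q x′)

  consistent-withSubsumption : {X : Claims _⟶_} → Consistent _⟶_ X →
                               Consistent _⟶_ (WithSubsumption X)
  consistent-withSubsumption {X} cX P Q (inj₁ x) =
    Rules-mono {X = X} {WithSubsumption X} inj₁ (cX P Q x)
  consistent-withSubsumption cX P Q (inj₂ P⊆Q) = inj₁ P⊆Q

  ∂∖-∪ : R ≐ A ∪ B → ∂ₛ (R ∖ₛ S) ≐ ∂ₛ (A ∖ₛ S) ∪ ∂ₛ (B ∖ₛ S)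
  ∂∖-∪ {R = R} {A = A} {B = B} {S = S} (R⊆A∪B , A∪B⊆R) = split , merge
    where
      split : ∂ₛ (R ∖ₛ S) ⊆ ∂ₛ (A ∖ₛ S) ∪ ∂ₛ (B ∖ₛ S)
      split (γ , (r , ¬s) , step) with R⊆A∪B r
      ... | inj₁ a = inj₁ (γ , (a , ¬s) , step)
      ... | inj₂ b = inj₂ (γ , (b , ¬s) , step)

      merge : ∂ₛ (A ∖ₛ S) ∪ ∂ₛ (B ∖ₛ S) ⊆ ∂ₛ (R ∖ₛ S)
      merge (inj₁ (γ , (a , ¬s) , step)) = γ , (A∪B⊆R (inj₁ a) , ¬s) , step
      merge (inj₂ (γ , (b , ¬s) , step)) = γ , (A∪B⊆R (inj₂ b) , ¬s) , step

  module _ (X : Claims _⟶_) where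

    Rules⇒⊆⊎satisfiable : Rules _⟶_ X A S → A ⊆ S ⊎ Satisfiable (A ∖ₛ S)
    Rules⇒⊆⊎satisfiable (inj₁ A⊆S)             = inj₁ A⊆S
    Rules⇒⊆⊎satisfiable (inj₂ ((sat , _) , _)) = inj₂ sat

    Rules⇒successor : Rules _⟶_ X A S → ∀ {γ} → (A ∖ₛ S) γ → ∃ λ γ′ → γ ⟶ γ′
    Rules⇒successor (inj₁ A⊆S)              (a , ¬s) = ⊥-elim (¬s (A⊆S a))
    Rules⇒successor (inj₂ ((_ , succ) , _)) γ∈A∖S    = succ γ∈A∖S

    module _ (subsumes : ∀ {P Q} → P ⊆ Q → X P Q) where

      Rules⇒∂-claim : Rules _⟶_ X A S → X (∂ₛ (A ∖ₛ S)) S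
      Rules⇒∂-claim (inj₁ A⊆S)        = subsumes λ { (_ , (a , ¬s) , _) → ⊥-elim (¬s (A⊆S a)) }
      Rules⇒∂-claim (inj₂ (_ , next)) = next

      step-∪ : R ≐ A ∪ B → Rules _⟶_ X A S → Rules _⟶_ X B S →
               Satisfiable (R ∖ₛ S) → Rules _⟶_ (UnionClosure X) R S
      step-∪ {R = R} {S = S} R≐A∪B@(R⊆A∪B , _) rulesA rulesB sat =
        inj₂ ( (sat , successor)
             , _ , _ , Rules⇒∂-claim rulesA , Rules⇒∂-claim rulesB , ∂∖-∪ R≐A∪B )
        where
          successor : ∀ {γ} → (R ∖ₛ S) γ → ∃ λ γ′ → γ ⟶ γ′
          successor (r , ¬s) with R⊆A∪B r
          ... | inj₁ a = Rules⇒successor rulesA (a , ¬s)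
          ... | inj₂ b = Rules⇒successor rulesB (b , ¬s)

      Rules-∪ : R ≐ A ∪ B → Rules _⟶_ X A S → Rules _⟶_ X B S →
                Rules _⟶_ (UnionClosure X) R S
      Rules-∪ R≐A∪B@(R⊆A∪B , A∪B⊆R) rulesA rulesB
        with Rules⇒⊆⊎satisfiable rulesA | Rules⇒⊆⊎satisfiable rulesB
      ... | inj₁ A⊆S | inj₁ B⊆S = inj₁ λ r → [ A⊆S , B⊆S ] (R⊆A∪B r)
      ... | inj₂ (γ , a , ¬s) | _ =
        step-∪ R≐A∪B rulesA rulesB (γ , A∪B⊆R (inj₁ a) , ¬s)
      ... | inj₁ _ | inj₂ (γ , b , ¬s) =
        step-∪ R≐A∪B rulesA rulesB (γ , A∪B⊆R (inj₂ b) , ¬s)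

      consistent-unionClosure : Consistent _⟶_ X → Consistent _⟶_ (UnionClosure X)
      consistent-unionClosure cX R S (A , B , xA , xB , R≐A∪B) =
        Rules-∪ R≐A∪B (cX A S xA) (cX B S xB)

proposition4 : ∀ {ℓ : Level} {M : Set ℓ} (_⟶_ : Rel M ℓ) (P₁ P₂ Q : Pred M ℓ) →
    _⊨∀_⇒_ _⟶_ P₁ Q → _⊨∀_⇒_ _⟶_ P₂ Q → _⊨∀_⇒_ _⟶_ (P₁ ∪ P₂) Q
proposition4 _⟶_ P₁ P₂ Q (X₁ , consistent₁ , x₁) (X₂ , consistent₂ , x₂) =
  UnionClosure _⟶_ X ,
  consistent-unionClosure _⟶_ X inj₂
    (consistent-withSubsumption _⟶_ (consistent-∪ᶜ _⟶_ consistent₁ consistent₂)) ,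
  (P₁ , P₂ , inj₁ (inj₁ x₁) , inj₁ (inj₂ x₂) , ≐-refl)
  where
    X : Claims _⟶_
    X = WithSubsumption _⟶_ (_∪ᶜ_ _⟶_ X₁ X₂)
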